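{- Let $s$ be a binary string over $\{a,b\}$ and let $(x,y)\in \Pi(s)$. Then there exists a substring $t$ of $s$ which begins and ends with a full $a$-run such that $p(t)=(x_1,y_1)$ with $x_1\geq x$ and $y_1\leq y$. Similarly, there exists a substring $t'$ of $s$ which begins and ends with a full $b$-run such that $p(t')=(x_2,y_2)$ with $x_2\leq x$ and $y_2\geq y$.
   Context: For a binary string $s=s_1\cdots s_n$ over $\{a,b\}$, a substring is $s_i\cdots s_j$ for $1\le i\le j\le n$. $|w|_a$ and $|w|_b$ denote the numbers of $a$'s and $b$'s in $w$, and the Parikh vector of $w$ is $p(w)=(|w|_a,|w|_b)$. The Parikh set $\Pi(s)$ is the set of Parikh vectors of all substrings of $s$. An $a$-run (resp. $b$-run) of $s$ is a maximal substring of $s$ consisting only of $a$'s (resp. only of $b$'s). A substring begins (resp. ends) with a full $a$-run if its first (resp. last) character lies in an $a$-run of $s$ and the substring contains that entire $a$-run; analogously for $b$-runs. -}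

module Defs where

open import Data.Nat using (ℕ; zero; suc; _+_; _∸_; _≤_; _<_)
open import Data.List using (List; []; _∷_; length; take; drop)
open import Data.Maybe using (Maybe; just; nothing)
open import Data.Product using (_×_; _,_; Σ; ∃-syntax)
open import Relation.Binary.PropositionalEquality using (_≡_)
open import Relation.Nullary using (¬_)

data Letter : Set where
  a b : Letter

-- Strings are lists of letters; position i (0-based) is s_{i+1} of the paper.
Str : Set
Str = List Letter

at : Str → ℕ → Maybe Letter
at []       _       = nothing
at (c ∷ _)  zero    = just c
at (_ ∷ s)  (suc i) = at s i

-- The substring occupying 0-based positions i..j (inclusive).
substr : Str → ℕ → ℕ → Str
substr s i j = take (suc j ∸ i) (drop i s)

count : Letter → Str → ℕ
count c [] = 0
count a (a ∷ w) = suc (count a w)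
count a (b ∷ w) = count a w
count b (a ∷ w) = count b w
count b (b ∷ w) = suc (count b w)

parikh : Str → ℕ × ℕ
parikh w = count a w , count b w

ValidPos : Str → ℕ → ℕ → Set
ValidPos s i j = (i ≤ j) × (j < length s)

InParikhSet : ℕ × ℕ → Str → Set
InParikhSet v s = ∃[ i ] ∃[ j ] (ValidPos s i j × parikh (substr s i j) ≡ v)

-- The substring s[i..j] begins with a full c-run: its first character is c
-- and the c-run containing it does not extend to the left (s_{i-1} ≠ c or i = 0).
BeginsFullRun : Letter → Str → ℕ → Set
BeginsFullRun c s i = (at s i ≡ just c) × (∀ k → suc k ≡ i → ¬ (at s k ≡ just c))

-- The substring s[i..j] ends with a full c-run: its last character is c
-- and the c-run does not extend to the right (s_{j+1} ≠ c or j = |s|-1).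
EndsFullRun : Letter → Str → ℕ → Set
EndsFullRun c s j = (at s j ≡ just c) × ¬ (at s (suc j) ≡ just c)

Occurs : Letter → Str → Set
Occurs c s = ∃[ k ] (at s k ≡ just c)

-- Write w ≼[ c ] w′ when w′ has at least as many c's as w and at most as many
-- of the other letter. Dropping a non-c letter from an end of a substring, or
-- extending it by an adjacent c, moves up in ≼[ c ]. So a substring containing
-- a c can be trimmed until it begins and ends with c and then extended until
-- both end runs are full; a substring without c lies below any single c, which
-- is extended in the same way.
module Submission where

open import Defs
open import Data.Nat using (ℕ; zero; suc; _+_; _∸_; _≤_; _<_; _≥_; z≤n; s≤s)
open import Data.Nat.Properties
open import Data.List using ([]; _∷_; _++_; _∷ʳ_; length; take; drop)
open import Data.Maybe using (just)
import Data.Maybe.Properties as Maybe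
open import Data.Product using (_×_; _,_; ∃-syntax)
open import Relation.Nullary using (¬_; Dec; yes; no; contradiction)
open import Relation.Binary.Definitions using (DecidableEquality)
open import Relation.Binary.PropositionalEquality

other : Letter → Letter
other a = b
other b = a

≢-other : ∀ c → c ≢ other c
≢-other a ()
≢-other b ()

_≟ᴸ_ : DecidableEquality Letter
a ≟ᴸ a = yes refl
a ≟ᴸ b = no λ ()
b ≟ᴸ a = no λ ()
b ≟ᴸ b = yes refl

count-∷ : ∀ e x w → count e (x ∷ w) ≡ count e (x ∷ []) + count e w
count-∷ a a w = refl
count-∷ a b w = refl
count-∷ b a w = refl
count-∷ b b w = refl

count-++ : ∀ e u v → count e (u ++ v) ≡ count e u + count e v
count-++ e []      v = refl
count-++ e (x ∷ u) v = begin
  count e (x ∷ u ++ v)                       ≡⟨ count-∷ e x (u ++ v) ⟩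
  count e (x ∷ []) + count e (u ++ v)        ≡⟨ cong (count e (x ∷ []) +_) (count-++ e u v) ⟩
  count e (x ∷ []) + (count e u + count e v) ≡⟨ +-assoc (count e (x ∷ [])) _ _ ⟨
  count e (x ∷ []) + count e u + count e v   ≡⟨ cong (_+ count e v) (count-∷ e x u) ⟨
  count e (x ∷ u) + count e v                ∎
  where open ≡-Reasoning

count-∷-self : ∀ c w → count c (c ∷ w) ≡ suc (count c w)
count-∷-self a w = refl
count-∷-self b w = refl

count-∷-≢ : ∀ {e x} w → x ≢ e → count e (x ∷ w) ≡ count e w
count-∷-≢ {a} {a} w x≢e = contradiction refl x≢e
count-∷-≢ {a} {b} w x≢e = refl
count-∷-≢ {b} {a} w x≢e = refl
count-∷-≢ {b} {b} w x≢e = contradiction refl x≢e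

count-∷-mono : ∀ e x w → count e w ≤ count e (x ∷ w)
count-∷-mono e x w = subst (count e w ≤_) (sym (count-∷ e x w)) (m≤n+m _ _)

count-∷ʳ-self : ∀ c w → count c (w ∷ʳ c) ≡ count c w + 1
count-∷ʳ-self c w = trans (count-++ c w (c ∷ [])) (cong (count c w +_) (count-∷-self c []))

count-∷ʳ-≢ : ∀ {e x} w → x ≢ e → count e (w ∷ʳ x) ≡ count e w
count-∷ʳ-≢ {e} w x≢e =
  trans (count-++ e w _) (trans (cong (count e w +_) (count-∷-≢ [] x≢e)) (+-identityʳ _))

count-∷ʳ-mono : ∀ e w x → count e w ≤ count e (w ∷ʳ x)
count-∷ʳ-mono e w x = subst (count e w ≤_) (sym (count-++ e w (x ∷ []))) (m≤m+n _ _)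

record _≼[_]_ (w : Str) (c : Letter) (w′ : Str) : Set where
  constructor _,_
  field
    more-c      : count c w ≤ count c w′
    fewer-other : count (other c) w′ ≤ count (other c) w
open _≼[_]_

≼-refl : ∀ {c} w → w ≼[ c ] w
≼-refl w = ≤-refl , ≤-refl

≼-trans : ∀ {c u v w} → u ≼[ c ] v → v ≼[ c ] w → u ≼[ c ] w
≼-trans (p , q) (p′ , q′) = ≤-trans p p′ , ≤-trans q′ q

≼-∷ : ∀ c w → w ≼[ c ] (c ∷ w)
≼-∷ c w = subst (count c w ≤_) (sym (count-∷-self c w)) (n≤1+n _)
        , ≤-reflexive (count-∷-≢ w (≢-other c))

≼-∷ʳ : ∀ c w → w ≼[ c ] (w ∷ʳ c)
≼-∷ʳ c w = subst (count c w ≤_) (sym (count-∷ʳ-self c w)) (m≤m+n _ 1)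
         , ≤-reflexive (count-∷ʳ-≢ w (≢-other c))

≢-∷-≼ : ∀ {c d} w → d ≢ c → (d ∷ w) ≼[ c ] w
≢-∷-≼ {c} {d} w d≢c = ≤-reflexive (count-∷-≢ w d≢c) , count-∷-mono (other c) d w

≢-∷ʳ-≼ : ∀ {c d} w → d ≢ c → (w ∷ʳ d) ≼[ c ] w
≢-∷ʳ-≼ {c} {d} w d≢c = ≤-reflexive (count-∷ʳ-≢ w d≢c) , count-∷ʳ-mono (other c) w d

absent-≼ : ∀ c w → count c w ≡ 0 → w ≼[ c ] (c ∷ [])
absent-≼ c w none = subst (_≤ count c (c ∷ [])) (sym none) z≤n
                  , subst (_≤ count (other c) w) (sym (count-∷-≢ [] (≢-other c))) z≤n

at-bound : ∀ s k {d} → at s k ≡ just d → k < length s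
at-bound (x ∷ s) zero    _ = s≤s z≤n
at-bound (x ∷ s) (suc k) p = s≤s (at-bound s k p)

at-defined : ∀ s k → k < length s → ∃[ d ] (at s k ≡ just d)
at-defined (x ∷ s) zero    _         = x , refl
at-defined (x ∷ s) (suc k) (s≤s k<n) = at-defined s k k<n

at-drop : ∀ s i n → at (drop i s) n ≡ at s (i + n)
at-drop []      zero    n = refl
at-drop []      (suc i) n = refl
at-drop (x ∷ s) zero    n = refl
at-drop (x ∷ s) (suc i) n = at-drop s i n

take-suc : ∀ w n {d} → at w n ≡ just d → take (suc n) w ≡ take n w ∷ʳ d
take-suc (x ∷ w) zero    refl = refl
take-suc (x ∷ w) (suc n) p    = cong (x ∷_) (take-suc w n p)

window : Str → ℕ → ℕ → Str
window s i m = take (suc m) (drop i s)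

substr-window : ∀ s i m → substr s i (i + m) ≡ window s i m
substr-window s i m = cong (λ n → take n (drop i s)) (begin
  suc (i + m) ∸ i ≡⟨ cong (_∸ i) (+-suc i m) ⟨
  i + suc m ∸ i   ≡⟨ m+n∸m≡n i (suc m) ⟩
  suc m           ∎)
  where open ≡-Reasoning

window-single : ∀ s i {d} → at s i ≡ just d → window s i 0 ≡ d ∷ []
window-single (x ∷ s) zero    refl = refl
window-single (x ∷ s) (suc i) p    = window-single s i p

window-∷ : ∀ s i m {d} → at s i ≡ just d → window s i (suc m) ≡ d ∷ window s (suc i) m
window-∷ (x ∷ s) zero    m refl = refl
window-∷ (x ∷ s) (suc i) m p    = window-∷ s i m p

window-∷ʳ : ∀ s i m {d} → at s (i + suc m) ≡ just d → window s i (suc m) ≡ window s i m ∷ʳ d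
window-∷ʳ s i m p = take-suc (drop i s) (suc m) (trans (at-drop s i (suc m)) p)

module _ (c : Letter) (s : Str) where

  at? : ∀ k → Dec (at s k ≡ just c)
  at? k = Maybe.≡-dec _≟ᴸ_ (at s k) (just c)

  other-at : ∀ k → k < length s → ¬ at s k ≡ just c → ∃[ d ] (at s k ≡ just d × d ≢ c)
  other-at k k<n notC with at-defined s k k<n
  ... | d , atd = d , atd , λ { refl → notC atd }

  window-growˡ : ∀ i m → at s i ≡ just c → window s (suc i) m ≼[ c ] window s i (suc m)
  window-growˡ i m first rewrite window-∷ s i m first = ≼-∷ c _

  window-growʳ : ∀ i m → at s (i + suc m) ≡ just c → window s i m ≼[ c ] window s i (suc m)
  window-growʳ i m last rewrite window-∷ʳ s i m last = ≼-∷ʳ c _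

  window-shrinkˡ : ∀ i m → i < length s → ¬ at s i ≡ just c → window s i (suc m) ≼[ c ] window s (suc i) m
  window-shrinkˡ i m i<n notC with other-at i i<n notC
  ... | d , first , d≢c rewrite window-∷ s i m first = ≢-∷-≼ _ d≢c

  window-shrinkʳ : ∀ i m → i + suc m < length s → ¬ at s (i + suc m) ≡ just c →
                   window s i (suc m) ≼[ c ] window s i m
  window-shrinkʳ i m bound notC with other-at (i + suc m) bound notC
  ... | d , last , d≢c rewrite window-∷ʳ s i m last = ≢-∷ʳ-≼ _ d≢c

  FullRunSpan : ℕ → ℕ → Set
  FullRunSpan i j = ValidPos s i j × BeginsFullRun c s i × EndsFullRun c s j

  Dominated : Str → Set
  Dominated w = ∃[ i ] ∃[ j ] (FullRunSpan i j × w ≼[ c ] substr s i j)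

  dominated-≼ : ∀ {w w′} → w ≼[ c ] w′ → Dominated w′ → Dominated w
  dominated-≼ w≼w′ (i , j , span , w′≼) = i , j , span , ≼-trans w≼w′ w′≼

  span-dominated : ∀ i m → FullRunSpan i (i + m) → Dominated (window s i m)
  span-dominated i m span =
    i , i + m , span , subst (window s i m ≼[ c ]_) (sym (substr-window s i m)) (≼-refl _)

  -- r counts the positions of s after the window; it decreases as the window grows.
  extendʳ : ∀ i m r → length s ≡ r + suc (i + m) →
            BeginsFullRun c s i → at s (i + m) ≡ just c → Dominated (window s i m)
  extendʳ i m r len begins last with at? (suc (i + m))
  ... | no notC = span-dominated i m ((m≤m+n i m , at-bound s _ last) , begins , last , notC)
  ... | yes nextC with r
  ...   | zero    = contradiction (at-bound s _ nextC) (<-irrefl (sym len))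
  ...   | suc r′  = dominated-≼ (window-growʳ i m next)
                                (extendʳ i (suc m) r′ len′ begins next)
    where
      next : at s (i + suc m) ≡ just c
      next = trans (cong (at s) (+-suc i m)) nextC
      len′ : length s ≡ r′ + suc (i + suc m)
      len′ = trans len (trans (sym (+-suc r′ (suc (i + m))))
                              (cong (λ k → r′ + suc k) (sym (+-suc i m))))

  extendʳ-from : ∀ i m → BeginsFullRun c s i → at s (i + m) ≡ just c → Dominated (window s i m)
  extendʳ-from i m begins last =
    extendʳ i m _ (sym (m∸n+n≡m (at-bound s _ last))) begins last

  extendˡ : ∀ i m → at s i ≡ just c → at s (i + m) ≡ just c → Dominated (window s i m)
  extendˡ zero    m first last = extendʳ-from zero m (first , λ _ ()) last
  extendˡ (suc i) m first last with at? i
  ... | no notC   = extendʳ-from (suc i) m (first , λ { _ refl → notC }) last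
  ... | yes prevC = dominated-≼ (window-growˡ i m prevC)
                      (extendˡ i (suc m) prevC (trans (cong (at s) (+-suc i m)) last))

  shrinkʳ : ∀ i m → at s i ≡ just c → i + m < length s → Dominated (window s i m)
  shrinkʳ i zero    first _ = extendˡ i zero first (subst (λ k → at s k ≡ just c) (sym (+-identityʳ i)) first)
  shrinkʳ i (suc m) first bound with at? (i + suc m)
  ... | yes lastC = extendˡ i (suc m) first lastC
  ... | no notC   = dominated-≼ (window-shrinkʳ i m bound notC)
                      (shrinkʳ i m first (≤-<-trans (+-monoʳ-≤ i (n≤1+n m)) bound))

  shrinkˡ : ∀ i m → i + m < length s → 0 < count c (window s i m) → Dominated (window s i m)
  shrinkˡ i m bound present with at? i
  ... | yes firstC = shrinkʳ i m firstC bound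
  shrinkˡ i zero bound present | no notC with other-at i (≤-<-trans (m≤m+n i 0) bound) notC
  ... | d , first , d≢c =
    contradiction (trans (cong (count c) (window-single s i first)) (count-∷-≢ [] d≢c))
                  (>⇒≢ present)
  shrinkˡ i (suc m) bound present | no notC =
    dominated-≼ shrunk (shrinkˡ (suc i) m (subst (_< length s) (+-suc i m) bound)
                                          (<-≤-trans present (more-c shrunk)))
    where
      shrunk : window s i (suc m) ≼[ c ] window s (suc i) m
      shrunk = window-shrinkˡ i m (≤-<-trans (m≤m+n i (suc m)) bound) notC

  window-dominated : ∀ i m → i + m < length s → Occurs c s → Dominated (window s i m)
  window-dominated i m bound (k , kC) with 0 <? count c (window s i m)
  ... | yes present = shrinkˡ i m bound present
  ... | no absent   =
    dominated-≼ (subst (window s i m ≼[ c ]_) (sym (window-single s k kC))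
                       (absent-≼ c _ (n≤0⇒n≡0 (≮⇒≥ absent))))
                (extendˡ k 0 kC (subst (λ n → at s n ≡ just c) (sym (+-identityʳ k)) kC))

  substr-dominated : ∀ i j → ValidPos s i j → Occurs c s → Dominated (substr s i j)
  substr-dominated i j (i≤j , j<n) occurs =
    subst Dominated (sym same) (window-dominated i (j ∸ i) bound occurs)
    where
      same : substr s i j ≡ window s i (j ∸ i)
      same = subst (λ k → substr s i k ≡ window s i (j ∸ i)) (m+[n∸m]≡n i≤j) (substr-window s i (j ∸ i))
      bound : i + (j ∸ i) < length s
      bound = subst (_< length s) (sym (m+[n∸m]≡n i≤j)) j<n

lemma1 : (s : Str) (x y : ℕ) → InParikhSet (x , y) s →
    (Occurs a s →
      ∃[ i ] ∃[ j ] ∃[ x₁ ] ∃[ y₁ ]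
        (ValidPos s i j × BeginsFullRun a s i × EndsFullRun a s j
          × parikh (substr s i j) ≡ (x₁ , y₁) × x₁ ≥ x × y₁ ≤ y))
    × (Occurs b s →
      ∃[ i ] ∃[ j ] ∃[ x₂ ] ∃[ y₂ ]
        (ValidPos s i j × BeginsFullRun b s i × EndsFullRun b s j
          × parikh (substr s i j) ≡ (x₂ , y₂) × x₂ ≤ x × y₂ ≥ y))
lemma1 s _ _ (i , j , valid , refl) =
  (λ occurs → let i′ , j′ , (valid′ , begins , ends) , moreA , fewerB = substr-dominated a s i j valid occurs
              in i′ , j′ , _ , _ , valid′ , begins , ends , refl , moreA , fewerB) ,
  (λ occurs → let i′ , j′ , (valid′ , begins , ends) , moreB , fewerA = substr-dominated b s i j valid occurs
              in i′ , j′ , _ , _ , valid′ , begins , ends , refl , fewerA , moreB)
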